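{- For every integer $k\geq 2$, the minimum number $N(k)$ of vertices in a pseudo $k$-regular graph satisfies $N(k)\geq k+3$.
   Context: All graphs are finite, simple and without isolated vertices. For a vertex $i$, $d_i$ is its degree and $m_i=d_i^{ -1}\sum_{j:\, ji\in E(G)} d_j$ is its average $2$-degree. A graph is $k$-harmonic if $m_i=k$ for all vertices $i$; it is pseudo $k$-regular if it is $k$-harmonic but not $k$-regular. $N(k)$ denotes the minimum number of vertices of a pseudo $k$-regular graph. -}

module Defs where

open import Data.Nat using (ℕ; _+_; _*_; _≤_)
open import Data.Bool using (Bool; true; false; if_then_else_)
open import Data.Fin using (Fin)
open import Data.List using (List; map)
open import Data.Nat.ListAction using (sum)
open import Data.List using () renaming (allFin to allFinL)
open import Relation.Binary.PropositionalEquality using (_≡_)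
open import Relation.Nullary using (¬_)

record Graph (n : ℕ) : Set where
  field
    adj    : Fin n → Fin n → Bool
    sym    : ∀ i j → adj i j ≡ adj j i
    irrefl : ∀ i → adj i i ≡ false
open Graph public

Σ[_] : {n : ℕ} → (Fin n → ℕ) → ℕ
Σ[_] {n} f = sum (map f (allFinL n))

degree : {n : ℕ} → Graph n → Fin n → ℕ
degree G i = Σ[ (λ j → if adj G i j then 1 else 0) ]

twoDegree : {n : ℕ} → Graph n → Fin n → ℕ
twoDegree G i = Σ[ (λ j → if adj G i j then degree G j else 0) ]

NoIsolated : {n : ℕ} → Graph n → Set
NoIsolated G = ∀ i → 1 ≤ degree G i

-- m_i = k, written as  Σ_{j ~ i} d_j = k · d_i  (d_i > 0, m_i = d_i⁻¹ Σ_{j~i} d_j)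
Harmonic : {n : ℕ} → ℕ → Graph n → Set
Harmonic k G = ∀ i → twoDegree G i ≡ k * degree G i

Regular : {n : ℕ} → ℕ → Graph n → Set
Regular k G = ∀ i → degree G i ≡ k

PseudoRegular : {n : ℕ} → ℕ → Graph n → Set
PseudoRegular k G = Harmonic k G × ¬ Regular k G
  where open import Data.Product using (_×_)

-- We show the contrapositive: every k-harmonic graph without isolated
-- vertices on n ≤ k + 2 vertices is k-regular.  In such a graph every
-- degree is at most n - 1 ≤ k + 1, so the excess  e j = (k + 1) - d j  is a
-- natural number, and k-harmonicity at i becomes the balance law
--   Σ_{j ~ i} e j = d i .
-- * If every excess is at least 1, the balance law is an equality between
--   Σ_{j ~ i} 1 and the pointwise larger Σ_{j ~ i} e j, so every neighbour
--   of every vertex has excess exactly 1, i.e. degree k: G is k-regular.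
-- * If some vertex v has excess 0, it has degree k + 1 = n - 1 and is
--   adjacent to everything; splitting Σ_j e j at v gives Σ_j e j = k + 1.
--   Splitting the same sum at any i shows that a non-neighbour j ≠ i would
--   have excess 0, hence be adjacent to everything, including i.  So G is
--   complete, every degree is n - 1 = k + 1, all excesses vanish, and
--   Σ_j e j = k + 1 is violated.

module Submission where

open import Defs hiding (sym)
open import Data.Nat using (ℕ; _+_; _≤_)
open import Data.Nat using (zero; suc; _*_; _∸_; _<_; _≤?_; _≟_; z≤n)
open import Data.Nat.Properties
open import Algebra.Properties.Semiring.Sum +-*-semiring
  using (sum; sum-cong-≗; sum-replicate-zero; sum-remove; ∑-distrib-+; *-distribˡ-sum)
open import Data.Bool using (true; false; if_then_else_)
open import Data.Bool.Properties using () renaming (_≟_ to _≟ᵇ_)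
open import Data.Fin using (Fin; punchIn; punchOut)
import Data.Fin as Fin
open import Data.Fin.Properties using (punchIn-punchOut; punchInᵢ≢i; any?)
  renaming (_≟_ to _≟ᶠ_)
open import Data.Vec.Functional using (removeAt)
import Data.List as List
open import Data.List.Properties using (map-tabulate)
import Data.Nat.ListAction as ListAction
open import Data.Product using (_,_; ∃)
open import Data.Empty using (⊥; ⊥-elim)
open import Relation.Nullary using (yes; no)
open import Relation.Binary.PropositionalEquality
open import Function using (id; _∘_)

Σ≡sum : ∀ {n} (f : Fin n → ℕ) → Σ[ f ] ≡ sum f
Σ≡sum f = trans (cong ListAction.sum (map-tabulate id f)) (sum-tabulate f)
  where
  sum-tabulate : ∀ {m} (h : Fin m → ℕ) → ListAction.sum (List.tabulate h) ≡ sum h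
  sum-tabulate {zero}  h = refl
  sum-tabulate {suc m} h = cong (h Fin.zero +_) (sum-tabulate (h ∘ Fin.suc))

sum-mono : ∀ {n} {f g : Fin n → ℕ} → (∀ j → f j ≤ g j) → sum f ≤ sum g
sum-mono {zero}  f≤g = z≤n
sum-mono {suc n} f≤g = +-mono-≤ (f≤g Fin.zero) (sum-mono (f≤g ∘ Fin.suc))

sum-ones : ∀ n → sum {n} (λ _ → 1) ≡ n
sum-ones zero    = refl
sum-ones (suc n) = cong suc (sum-ones n)

sum-zero : ∀ {n} {f : Fin n → ℕ} → (∀ j → f j ≡ 0) → sum f ≡ 0
sum-zero {n} f≡0 = trans (sum-cong-≗ f≡0) (sum-replicate-zero n)

sum-single : ∀ {n} (f : Fin n → ℕ) i → (∀ j → j ≢ i → f j ≡ 0) → sum f ≡ f i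
sum-single {suc n} f i others = begin
  sum f                        ≡⟨ sum-remove f ⟩
  f i + sum (removeAt f i)     ≡⟨ cong (f i +_) (sum-zero λ l → others _ (punchInᵢ≢i i l)) ⟩
  f i + 0                      ≡⟨ +-identityʳ (f i) ⟩
  f i                          ∎
  where open ≡-Reasoning

term≤sum : ∀ {n} (f : Fin n → ℕ) i → f i ≤ sum f
term≤sum {suc n} f i = ≤-trans (m≤m+n (f i) _) (≤-reflexive (sym (sum-remove f)))

two-terms≤sum : ∀ {n} (f : Fin n → ℕ) {i j} → i ≢ j → f i + f j ≤ sum f
two-terms≤sum {suc n} f {i} {j} i≢j = begin
  f i + f j                          ≡⟨ cong (λ l → f i + f l) (sym (punchIn-punchOut i≢j)) ⟩
  f i + removeAt f i (punchOut i≢j)  ≤⟨ +-monoʳ-≤ (f i) (term≤sum (removeAt f i) _) ⟩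
  f i + sum (removeAt f i)           ≡⟨ sum-remove f ⟨
  sum f                              ∎
  where open ≤-Reasoning

sum-tight : ∀ {n} {f g : Fin n → ℕ} → (∀ j → f j ≤ g j) → sum g ≤ sum f →
            ∀ j → f j ≡ g j
sum-tight {suc n} {f} {g} f≤g Σg≤Σf j =
  ≤-antisym (f≤g j) (+-cancelʳ-≤ (sum (removeAt g j)) (g j) (f j) (begin
    g j + sum (removeAt g j)  ≡⟨ sum-remove g ⟨
    sum g                     ≤⟨ Σg≤Σf ⟩
    sum f                     ≡⟨ sum-remove f ⟩
    f j + sum (removeAt f j)  ≤⟨ +-monoʳ-≤ (f j) (sum-mono (f≤g ∘ punchIn j)) ⟩
    f j + sum (removeAt g j)  ∎))
  where open ≤-Reasoning

-- Σ_{j ~ i} f j, and Σ_{j ≁ i} f j where j ≁ i includes j = i.  The degree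
-- and the 2-degree are neighbourhood sums of 1 and of the degree.
nbrSum : ∀ {n} → Graph n → Fin n → (Fin n → ℕ) → ℕ
nbrSum G i f = sum (λ j → if adj G i j then f j else 0)

nonNbrSum : ∀ {n} → Graph n → Fin n → (Fin n → ℕ) → ℕ
nonNbrSum G i f = sum (λ j → if adj G i j then 0 else f j)

module _ {n : ℕ} (G : Graph n) where

  degree-nbrSum : ∀ i → degree G i ≡ nbrSum G i (λ _ → 1)
  degree-nbrSum i = Σ≡sum (λ j → if adj G i j then 1 else 0)

  twoDegree-nbrSum : ∀ i → twoDegree G i ≡ nbrSum G i (degree G)
  twoDegree-nbrSum i = Σ≡sum (λ j → if adj G i j then degree G j else 0)

  sum-split : ∀ i (f : Fin n → ℕ) → sum f ≡ nbrSum G i f + nonNbrSum G i f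
  sum-split i f = trans (sum-cong-≗ split)
    (∑-distrib-+ (λ j → if adj G i j then f j else 0) (λ j → if adj G i j then 0 else f j))
    where
    split : ∀ j → f j ≡ (if adj G i j then f j else 0) + (if adj G i j then 0 else f j)
    split j with adj G i j
    ... | true  = sym (+-identityʳ (f j))
    ... | false = refl

  nbrSum-+ : ∀ i (f g : Fin n → ℕ) → nbrSum G i (λ j → f j + g j) ≡ nbrSum G i f + nbrSum G i g
  nbrSum-+ i f g = trans (sum-cong-≗ masked-+)
    (∑-distrib-+ (λ j → if adj G i j then f j else 0) (λ j → if adj G i j then g j else 0))
    where
    masked-+ : ∀ j → (if adj G i j then f j + g j else 0)
                   ≡ (if adj G i j then f j else 0) + (if adj G i j then g j else 0)
    masked-+ j with adj G i j
    ... | true  = refl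
    ... | false = refl

  nbrSum-const : ∀ i (c : ℕ) → nbrSum G i (λ _ → c) ≡ c * degree G i
  nbrSum-const i c = begin
    nbrSum G i (λ _ → c)         ≡⟨ sum-cong-≗ masked-* ⟩
    sum (λ j → c * ind j)        ≡⟨ *-distribˡ-sum c ind ⟨
    c * sum ind                  ≡⟨ cong (c *_) (degree-nbrSum i) ⟨
    c * degree G i               ∎
    where
    open ≡-Reasoning
    ind : Fin n → ℕ
    ind j = if adj G i j then 1 else 0
    masked-* : ∀ j → (if adj G i j then c else 0) ≡ c * ind j
    masked-* j with adj G i j
    ... | true  = sym (*-identityʳ c)
    ... | false = sym (*-zeroʳ c)

  nbrSum-tight : ∀ {i} {f g : Fin n → ℕ} → (∀ j → f j ≤ g j) → nbrSum G i g ≤ nbrSum G i f →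
                 ∀ {j} → adj G i j ≡ true → f j ≡ g j
  nbrSum-tight {i} {f} {g} f≤g Σg≤Σf {j} i~j =
    subst (λ b → (if b then f j else 0) ≡ (if b then g j else 0)) i~j
          (sum-tight masked-≤ Σg≤Σf j)
    where
    masked-≤ : ∀ l → (if adj G i l then f l else 0) ≤ (if adj G i l then g l else 0)
    masked-≤ l with adj G i l
    ... | true  = f≤g l
    ... | false = z≤n

  nonNbrSum-self : ∀ i (f : Fin n → ℕ) → (if adj G i i then 0 else f i) ≡ f i
  nonNbrSum-self i f rewrite irrefl G i = refl

  count-vertices : ∀ i → degree G i + nonNbrSum G i (λ _ → 1) ≡ n
  count-vertices i = begin
    degree G i + nonNbrSum G i (λ _ → 1)            ≡⟨ cong (_+ nonNbrSum G i (λ _ → 1)) (degree-nbrSum i) ⟩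
    nbrSum G i (λ _ → 1) + nonNbrSum G i (λ _ → 1)  ≡⟨ sum-split i (λ _ → 1) ⟨
    sum {n} (λ _ → 1)                               ≡⟨ sum-ones n ⟩
    n                                               ∎
    where open ≡-Reasoning

  -- A vertex is not its own neighbour, so d i ≤ n - 1.
  degree<n : ∀ i → degree G i < n
  degree<n i = begin-strict
    degree G i                             <⟨ m<m+n (degree G i) self≥1 ⟩
    degree G i + nonNbrSum G i (λ _ → 1)   ≡⟨ count-vertices i ⟩
    n                                      ∎
    where
    open ≤-Reasoning
    self≥1 : 0 < nonNbrSum G i (λ _ → 1)
    self≥1 = ≤-trans (≤-reflexive (sym (nonNbrSum-self i (λ _ → 1))))
                     (term≤sum (λ j → if adj G i j then 0 else 1) i)

  -- A vertex with a non-neighbour other than itself misses two vertices.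
  non-adjacent⇒degree+2≤n : ∀ {i j} → j ≢ i → adj G i j ≡ false → degree G i + 2 ≤ n
  non-adjacent⇒degree+2≤n {i} {j} j≢i i≁j = begin
    degree G i + 2                                            ≡⟨ cong (degree G i +_) two ⟩
    degree G i + (nonNbr i + nonNbr j)                        ≤⟨ +-monoʳ-≤ (degree G i)
                                                                   (two-terms≤sum nonNbr (j≢i ∘ sym)) ⟩
    degree G i + nonNbrSum G i (λ _ → 1)                      ≡⟨ count-vertices i ⟩
    n                                                         ∎
    where
    open ≤-Reasoning
    nonNbr : Fin n → ℕ
    nonNbr l = if adj G i l then 0 else 1
    two : 2 ≡ nonNbr i + nonNbr j
    two = sym (cong₂ _+_ (nonNbrSum-self i (λ _ → 1)) (cong (λ b → if b then 0 else 1) i≁j))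

  universal⇒degree : ∀ {i} → (∀ j → j ≢ i → adj G i j ≡ true) → suc (degree G i) ≡ n
  universal⇒degree {i} universal = begin
    suc (degree G i)                       ≡⟨ +-comm 1 (degree G i) ⟩
    degree G i + 1                         ≡⟨ cong (degree G i +_) only-self ⟨
    degree G i + nonNbrSum G i (λ _ → 1)   ≡⟨ count-vertices i ⟩
    n                                      ∎
    where
    open ≡-Reasoning
    others-zero : ∀ j → j ≢ i → (if adj G i j then 0 else 1) ≡ 0
    others-zero j j≢i rewrite universal j j≢i = refl
    only-self : nonNbrSum G i (λ _ → 1) ≡ 1
    only-self = trans (sum-single (λ j → if adj G i j then 0 else 1) i others-zero) (nonNbrSum-self i (λ _ → 1))

  has-neighbour : ∀ {i} → 1 ≤ degree G i → ∃ λ j → adj G i j ≡ true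
  has-neighbour {i} 1≤d with any? (λ j → adj G i j ≟ᵇ true)
  ... | yes found = found
  ... | no none   = ⊥-elim (<⇒≱ 1≤d (≤-reflexive (trans (degree-nbrSum i) (sum-zero masked-zero))))
    where
    masked-zero : ∀ j → (if adj G i j then 1 else 0) ≡ 0
    masked-zero j with adj G i j in i~j
    ... | true  = ⊥-elim (none (j , i~j))
    ... | false = refl

module SmallHarmonic (k : ℕ) {n : ℕ} (G : Graph n)
                     (small : n ≤ suc (suc k)) (harmonic : Harmonic k G) where

  d : Fin n → ℕ
  d = degree G

  degree≤k+1 : ∀ j → d j ≤ suc k
  degree≤k+1 j = <⇒≤pred (≤-trans (degree<n G j) small)

  excess : Fin n → ℕ
  excess j = suc k ∸ d j

  degree+excess : ∀ j → d j + excess j ≡ suc k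
  degree+excess j = m+[n∸m]≡n (degree≤k+1 j)

  -- k-harmonicity in terms of the excess:  Σ_{j ~ i} e j = d i,  obtained by
  -- cancelling k · d i from  Σ_{j ~ i} (d j + e j) = (k + 1) · d i.
  balance : ∀ i → nbrSum G i excess ≡ d i
  balance i = +-cancelˡ-≡ (k * d i) _ _ (begin
    k * d i + nbrSum G i excess               ≡⟨ cong (_+ nbrSum G i excess) (trans (sym (harmonic i)) (twoDegree-nbrSum G i)) ⟩
    nbrSum G i d + nbrSum G i excess          ≡⟨ nbrSum-+ G i d excess ⟨
    nbrSum G i (λ j → d j + excess j)         ≡⟨ sum-cong-≗ (λ j → cong (if adj G i j then_else 0) (degree+excess j)) ⟩
    nbrSum G i (λ _ → suc k)                  ≡⟨ nbrSum-const G i (suc k) ⟩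
    d i + k * d i                             ≡⟨ +-comm (d i) (k * d i) ⟩
    k * d i + d i                             ∎)
    where open ≡-Reasoning

  total-excess : ∀ i → sum excess ≡ d i + nonNbrSum G i excess
  total-excess i = trans (sum-split G i excess) (cong (_+ nonNbrSum G i excess) (balance i))

  -- If every excess is positive, all neighbours have excess 1: G is k-regular.
  positive-excess⇒regular : NoIsolated G → (∀ j → 1 ≤ excess j) → Regular k G
  positive-excess⇒regular noIsolated excess≥1 j with has-neighbour G (noIsolated j)
  ... | i , j~i = +-cancelʳ-≡ 1 (d j) k (begin
    d j + 1         ≡⟨ cong (d j +_) excess≡1 ⟩
    d j + excess j  ≡⟨ degree+excess j ⟩
    suc k           ≡⟨ +-comm 1 k ⟩
    k + 1           ∎)
    where
    open ≡-Reasoning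
    sums-agree : nbrSum G i excess ≤ nbrSum G i (λ _ → 1)
    sums-agree = ≤-reflexive (trans (balance i) (degree-nbrSum G i))
    excess≡1 : 1 ≡ excess j
    excess≡1 = nbrSum-tight G excess≥1 sums-agree (trans (Graph.sym G i j) j~i)

  max-degree⇒universal : ∀ {j} → d j ≡ suc k → ∀ l → l ≢ j → adj G j l ≡ true
  max-degree⇒universal {j} dj≡k+1 l l≢j with adj G j l in j≁l
  ... | true  = refl
  ... | false = ⊥-elim (1+n≰n (+-cancelˡ-≤ (suc k) 2 1 (begin
    suc k + 2      ≡⟨ cong (_+ 2) dj≡k+1 ⟨
    d j + 2        ≤⟨ non-adjacent⇒degree+2≤n G l≢j j≁l ⟩
    n              ≤⟨ small ⟩
    suc (suc k)    ≡⟨ +-comm 1 (suc k) ⟩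
    suc k + 1      ∎)))
    where open ≤-Reasoning

  zero-excess⇒max-degree : ∀ {j} → excess j ≡ 0 → d j ≡ suc k
  zero-excess⇒max-degree {j} e≡0 = trans (sym (+-identityʳ (d j)))
                                         (trans (cong (d j +_) (sym e≡0)) (degree+excess j))

  module ZeroExcess (v : Fin n) (excess-v≡0 : excess v ≡ 0) where

    -- v is adjacent to all other vertices, so splitting at v gives Σ_j e j = d v.
    total-excess≡k+1 : sum excess ≡ suc k
    total-excess≡k+1 = begin
      sum excess                  ≡⟨ total-excess v ⟩
      d v + nonNbrSum G v excess  ≡⟨ cong (d v +_) (sum-zero only-v) ⟩
      d v + 0                     ≡⟨ +-identityʳ (d v) ⟩
      d v                         ≡⟨ zero-excess⇒max-degree excess-v≡0 ⟩
      suc k                       ∎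
      where
      open ≡-Reasoning
      only-v : ∀ j → (if adj G v j then 0 else excess j) ≡ 0
      only-v j with j ≟ᶠ v
      ... | yes refl = trans (nonNbrSum-self G v excess) excess-v≡0
      ... | no j≢v rewrite max-degree⇒universal (zero-excess⇒max-degree excess-v≡0) j j≢v = refl

    -- Splitting Σ_j e j = k + 1 at i: the terms d i + e i already make up
    -- k + 1, so every other non-neighbour of i has excess 0.
    non-neighbour⇒zero-excess : ∀ {i j} → j ≢ i → adj G i j ≡ false → excess j ≡ 0
    non-neighbour⇒zero-excess {i} {j} j≢i i≁j = n≤0⇒n≡0 (+-cancelˡ-≤ (suc k) _ _ (begin
      suc k + excess j                         ≡⟨ cong (_+ excess j) (degree+excess i) ⟨
      d i + excess i + excess j                ≡⟨ +-assoc (d i) (excess i) (excess j) ⟩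
      d i + (excess i + excess j)              ≡⟨ cong₂ (λ x y → d i + (x + y)) at-i at-j ⟨
      d i + (nonNbrExcess i + nonNbrExcess j)  ≤⟨ +-monoʳ-≤ (d i) (two-terms≤sum nonNbrExcess (j≢i ∘ sym)) ⟩
      d i + nonNbrSum G i excess               ≡⟨ total-excess i ⟨
      sum excess                               ≡⟨ total-excess≡k+1 ⟩
      suc k                                    ≡⟨ +-identityʳ (suc k) ⟨
      suc k + 0                                ∎))
      where
      open ≤-Reasoning
      nonNbrExcess : Fin n → ℕ
      nonNbrExcess l = if adj G i l then 0 else excess l
      at-i : nonNbrExcess i ≡ excess i
      at-i = nonNbrSum-self G i excess
      at-j : nonNbrExcess j ≡ excess j
      at-j = cong (λ b → if b then 0 else excess j) i≁j

    -- A non-neighbour would have degree k + 1 and so be adjacent after all.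
    complete : ∀ i j → j ≢ i → adj G i j ≡ true
    complete i j j≢i with adj G i j in i≁j
    ... | true  = refl
    ... | false = ⊥-elim (true≢false (begin
      true      ≡⟨ max-degree⇒universal (zero-excess⇒max-degree excess-j≡0) i (j≢i ∘ sym) ⟨
      adj G j i ≡⟨ Graph.sym G j i ⟩
      adj G i j ≡⟨ i≁j ⟩
      false     ∎))
      where
      open ≡-Reasoning
      excess-j≡0 : excess j ≡ 0
      excess-j≡0 = non-neighbour⇒zero-excess j≢i i≁j
      true≢false : true ≢ false
      true≢false ()

    -- In the complete graph every degree is n - 1 = d v = k + 1.
    all-excess-zero : ∀ j → excess j ≡ 0
    all-excess-zero j = trans (cong (suc k ∸_) dj≡k+1) (n∸n≡0 (suc k))
      where
      open ≡-Reasoning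
      dj≡k+1 : d j ≡ suc k
      dj≡k+1 = suc-injective (begin
        suc (d j)    ≡⟨ universal⇒degree G (complete j) ⟩
        n            ≡⟨ universal⇒degree G (complete v) ⟨
        suc (d v)    ≡⟨ cong suc (zero-excess⇒max-degree excess-v≡0) ⟩
        suc (suc k)  ∎)

    contradiction : ⊥
    contradiction = 0≢1+n (trans (sym (sum-zero all-excess-zero)) total-excess≡k+1)

  harmonic⇒regular : NoIsolated G → Regular k G
  harmonic⇒regular noIsolated with any? (λ j → excess j ≟ 0)
  ... | yes (v , excess-v≡0) = ⊥-elim (ZeroExcess.contradiction v excess-v≡0)
  ... | no  none             = positive-excess⇒regular noIsolated
                                 (λ j → n≢0⇒n>0 (λ excess-j≡0 → none (j , excess-j≡0)))

-- Every k-harmonic graph without isolated vertices on at most k + 2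
-- vertices is k-regular, so a pseudo k-regular graph needs k + 3 vertices.
proposition5p3 : (k : ℕ) → 2 ≤ k → (n : ℕ) → (G : Graph n) →
                   NoIsolated G → PseudoRegular k G → k + 3 ≤ n
proposition5p3 k _ n G noIsolated (harmonic , notRegular) with k + 3 ≤? n
... | yes k+3≤n = k+3≤n
... | no  k+3≰n = ⊥-elim (notRegular (SmallHarmonic.harmonic⇒regular k G small harmonic noIsolated))
  where
  small : n ≤ suc (suc k)
  small = ≤-pred (≤-trans (≰⇒> k+3≰n) (≤-reflexive (+-comm k 3)))
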